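{- Let $G$ be a strongly connected digraph with $n\ge 3$ vertices and $m=2n-1$ arcs. Then $\mathrm{Rel}(D_n,p)\ge \mathrm{Rel}(G,p)$ for all $p\in[0,1]$, where $D_n$ is obtained from $S_n$ (the star $K_{1,n-1}$ with every edge replaced by a bundle) by adding one arc between two of its leaves.
   Context: Digraphs are finite, without loops and without two arcs in the same direction between the same ordered pair of vertices. A bundle is a pair of antiparallel arcs $u\to v$, $v\to u$ between distinct vertices. Strongly connected node reliability: each vertex of a digraph $G$ is independently operational with probability $p\in[0,1]$, and $\mathrm{Rel}(G,p)$ is the probability that the set of operational vertices is nonempty and induces a strongly connected subdigraph (a single vertex counts as strongly connected).
   Formalization: The probability p ranges only over the rationals in $[0,1]$ rather than over all real numbers in that interval. -}

module Defs where

open import Data.Bool using (Bool; true; false; _∧_; _∨_; not; if_then_else_; T)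
open import Data.Nat using (ℕ; zero; suc; _+_; _*_; _∸_)
open import Data.Fin using (Fin; zero; suc; toℕ)
open import Data.Fin.Properties using (_≟_)
open import Data.Vec using (Vec; []; _∷_; lookup)
open import Data.List using (List; []; _∷_; map; _++_; foldr; allFin)
open import Data.Rational using (ℚ; 0ℚ; 1ℚ; _-_) renaming (_+_ to _+ℚ_; _*_ to _*ℚ_)
open import Relation.Nullary.Decidable using (⌊_⌋)
open import Relation.Binary.PropositionalEquality using (_≡_)

-- A digraph on vertex set Fin n: an arc relation u → v (Boolean-valued,
-- so there is at most one arc per ordered pair) without loops.
record Digraph (n : ℕ) : Set where
  field
    arc      : Fin n → Fin n → Bool
    loopless : ∀ i → arc i i ≡ false
open Digraph public

anyFin : ∀ {n} → (Fin n → Bool) → Bool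
anyFin {n} f = foldr (λ i b → f i ∨ b) false (allFin n)

allFin? : ∀ {n} → (Fin n → Bool) → Bool
allFin? {n} f = foldr (λ i b → f i ∧ b) true (allFin n)

b2n : Bool → ℕ
b2n true  = 1
b2n false = 0

sumFin : ∀ {n} → (Fin n → ℕ) → ℕ
sumFin {n} f = foldr (λ i s → f i + s) 0 (allFin n)

arcCount : ∀ {n} → Digraph n → ℕ
arcCount {n} G = sumFin (λ u → sumFin (λ v → b2n (arc G u v)))

-- vertex subsets: S i = true means vertex i is in S
Subset : ℕ → Set
Subset n = Vec Bool n

walkWithin : ∀ {n} → Digraph n → Subset n → ℕ → Fin n → Fin n → Bool
walkWithin G S zero    u v = lookup S u ∧ ⌊ u ≟ v ⌋
walkWithin G S (suc k) u v =
  walkWithin G S k u v ∨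
  (lookup S u ∧ anyFin (λ w → arc G u w ∧ walkWithin G S k w v))

-- The subdigraph induced by S is strongly connected: every ordered pair of
-- vertices of S is joined by a directed walk inside S (walks of length ≤ n
-- suffice, since any walk contains a path of length < n).
inducesStronglyConnected : ∀ {n} → Digraph n → Subset n → Bool
inducesStronglyConnected {n} G S =
  allFin? (λ u → allFin? (λ v →
    not (lookup S u ∧ lookup S v) ∨ walkWithin G S n u v))

nonempty : ∀ {n} → Subset n → Bool
nonempty {n} S = anyFin (lookup S)

StronglyConnected : ∀ {n} → Digraph n → Set
StronglyConnected {n} G = T (inducesStronglyConnected G (Data.Vec.replicate n true))

subsets : (n : ℕ) → List (Subset n)
subsets zero    = [] ∷ []
subsets (suc n) = map (true ∷_) (subsets n) ++ map (false ∷_) (subsets n)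

-- probability of the operational set being exactly S
weight : ∀ {n} → ℚ → Subset n → ℚ
weight p []          = 1ℚ
weight p (true  ∷ S) = p *ℚ weight p S
weight p (false ∷ S) = (1ℚ - p) *ℚ weight p S

Rel : ∀ {n} → Digraph n → ℚ → ℚ
Rel {n} G p =
  foldr (λ S acc →
           (if nonempty S ∧ inducesStronglyConnected G S then weight p S else 0ℚ) +ℚ acc)
        0ℚ (subsets n)

-- D_n for n = k + 3: vertex 0 is the centre, bundles 0 ↔ i for every leaf i,
-- plus one extra arc from leaf 1 to leaf 2.
Darc : ∀ k → Fin (3 + k) → Fin (3 + k) → Bool
Darc k zero    zero    = false
Darc k zero    (suc _) = true
Darc k (suc _) zero    = true
Darc k (suc zero) (suc (suc zero)) = true
Darc k (suc _) (suc _) = false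

Darc-loopless : ∀ k i → Darc k i i ≡ false
Darc-loopless k zero = Relation.Binary.PropositionalEquality.refl
Darc-loopless k (suc zero) = Relation.Binary.PropositionalEquality.refl
Darc-loopless k (suc (suc i)) = Relation.Binary.PropositionalEquality.refl

D : ∀ k → Digraph (3 + k)
D k = record { arc = Darc k ; loopless = Darc-loopless k }

-- Writing N_r(G) for the number of r-element vertex sets that induce a strongly connected
-- subdigraph, Rel(G, p) = Σ_r N_r(G) p^r (1 - p)^(n - r), so it suffices to show
-- N_r(G) ≤ N_r(D_n) for every r.  For r ≤ 1 both sides count all nonempty sets of size r,
-- and in D_n every set containing the centre is strongly connected, so
-- N_r(D_n) ≥ C(n - 1, r - 1).
--
-- Conversely, if G has m < 2N arcs and at most N non-isolated vertices, then
-- N_r(G) ≤ C(N - 1, r - 1) for r ≥ 2.  Pick a non-isolated vertex v minimising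
-- d = min(indeg v, outdeg v) and let I be a d-element in- or out-neighbourhood of v.  A strong
-- set of size r either avoids v, and is then strong in G with v isolated (at most m - 2d
-- arcs), or it contains v, consists of non-isolated vertices and meets I; with x non-isolated
-- vertices there are at most C(x - 1, r - 1) - C(x - d - 1, r - 1) of the latter.  Every
-- non-isolated vertex has out-degree ≥ d, so d x ≤ m < 2N, which forces x + d ≤ N + 1;
-- induction with N - d in place of N and the convexity of k ↦ C(k, r - 1) finish the bound.

module Submission where

open import Algebra.Bundles using (CommutativeMonoid)
open import Data.Bool using (Bool; true; false; _∧_; _∨_; not; if_then_else_; T)
open import Data.Bool.Properties using (T-∧; T-∨; T-≡; ∧-identityʳ; ∧-zeroʳ; ∧-commutativeMonoid)
open import Data.Empty using (⊥-elim)
open import Data.Fin using (Fin; zero; suc)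
open import Data.Fin.Properties using (_≟_; suc-injective)
open import Data.Fin.Subset using (∣_∣)
open import Data.Fin.Subset.Properties using (∣p∣≤n)
open import Data.List using (List; []; _∷_; _++_; foldr; allFin; tabulate; map; filter)
open import Data.List.Membership.Propositional using (lose)
open import Data.List.Membership.Propositional.Properties using (∈-allFin; ∈-filter⁺; ∈-filter⁻)
open import Data.List.Properties using (foldr-map; map-tabulate)
import Data.List.Relation.Unary.All as All
open import Data.List.Relation.Unary.All.Properties using (all⁺; all⁻)
open import Data.List.Relation.Unary.Any using (satisfied)
open import Data.List.Relation.Unary.Any.Properties using (any⁺; any⁻)
open import Data.Nat using (ℕ; zero; suc; _+_; _*_; _∸_; _⊓_; z≤n; s≤s; s≤s⁻¹; _≡ᵇ_)
open import Data.Nat.Induction using (<-wellFounded)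
open import Data.Nat.Combinatorics using (_C_; nCk+nC[k+1]≡[n+1]C[k+1])
open import Data.Nat.Properties as ℕ using ()
open import Data.Nat.Tactic.RingSolver using (solve-∀)
open import Data.List.Extrema ℕ.≤-totalOrder using (argmin; argmin-all; f[argmin]≤v⁺)
open import Data.Product using (∃; _×_; _,_; proj₁; proj₂; curry)
open import Data.Rational using (ℚ; 0ℚ; 1ℚ; _-_; -_; nonNegative)
  renaming (_≤_ to _≤ℚ_; _+_ to _+ℚ_; _*_ to _*ℚ_)
import Data.Rational.Properties as ℚ
open import Data.Sum using (_⊎_; inj₁; inj₂)
open import Data.Vec using ([]; _∷_; lookup)
open import Function using (_∘_; id; Equivalence)
open import Induction.WellFounded using (Acc; acc)
open import Relation.Binary.PropositionalEquality
  using (_≡_; _≢_; refl; sym; trans; cong; cong₂; subst; subst₂; _≗_; module ≡-Reasoning)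
open import Relation.Nullary using (¬_; Dec; contradiction)
open import Relation.Nullary.Decidable using (⌊_⌋; yes; no; toWitness; fromWitness; T?)

open import Algebra.Properties.CommutativeSemigroup
  (CommutativeMonoid.commutativeSemigroup ∧-commutativeMonoid)
  using () renaming (x∙yz≈y∙xz to ∧-left-comm)
open import Algebra.Properties.CommutativeSemigroup ℕ.+-commutativeSemigroup
  using () renaming (interchange to +-interchange)
open import Algebra.Properties.CommutativeSemigroup
  (CommutativeMonoid.commutativeSemigroup ℚ.+-0-commutativeMonoid)
  using () renaming (interchange to +ℚ-interchange)
open import Algebra.Properties.CommutativeSemigroup
  (CommutativeMonoid.commutativeSemigroup ℚ.*-1-commutativeMonoid)
  using () renaming (x∙yz≈y∙xz to ℚ-left-comm)
open import Algebra.Properties.Monoid.Mult ℚ.+-0-monoid using (×-homo-+) renaming (_×_ to _·_)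

open import Defs

module _ where
  open import Data.Nat using (_≤_; _<_; _≤?_)

  module _ {x y : Bool} where

    T-∧⁺ : T x → T y → T (x ∧ y)
    T-∧⁺ = curry (Equivalence.from T-∧)

    T-∧⁻ˡ : T (x ∧ y) → T x
    T-∧⁻ˡ = proj₁ ∘ Equivalence.to T-∧

    T-∧⁻ʳ : T (x ∧ y) → T y
    T-∧⁻ʳ = proj₂ ∘ Equivalence.to T-∧

    T-∨⁺ˡ : T x → T (x ∨ y)
    T-∨⁺ˡ = Equivalence.from T-∨ ∘ inj₁

    T-∨⁺ʳ : T y → T (x ∨ y)
    T-∨⁺ʳ = Equivalence.from T-∨ ∘ inj₂

    T-∨⁻ : T (x ∨ y) → T x ⊎ T y
    T-∨⁻ = Equivalence.to T-∨

  T-not⁺ : ∀ {x} → ¬ T x → T (not x)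
  T-not⁺ {true}  ¬t = ¬t _
  T-not⁺ {false} _  = _

  T-not⁻ : ∀ {x} → T (not x) → ¬ T x
  T-not⁻ {false} _ ()

  T-≟-refl : ∀ {n} (a : Fin n) → T ⌊ a ≟ a ⌋
  T-≟-refl a = fromWitness refl

  T-≟⁻ : ∀ {n} {a b : Fin n} → T ⌊ a ≟ b ⌋ → a ≡ b
  T-≟⁻ = toWitness

  foldr-allFin-suc : ∀ {B : Set} {n} (f : Fin (suc n) → B → B) e →
                     foldr f e (allFin (suc n)) ≡ f zero (foldr (f ∘ suc) e (allFin n))
  foldr-allFin-suc {n = n} f e = cong (f zero) (begin
    foldr f e (tabulate suc)            ≡⟨ cong (foldr f e) (map-tabulate id suc) ⟨
    foldr f e (map suc (allFin n))      ≡⟨ foldr-map f suc e (allFin n) ⟩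
    foldr (f ∘ suc) e (allFin n)        ∎)
    where open ≡-Reasoning

  anyFin⁺ : ∀ {n} (f : Fin n → Bool) i → T (f i) → T (anyFin f)
  anyFin⁺ {n} f i fi =
    subst T (foldr-map _∨_ f false (allFin n)) (any⁺ f (lose (∈-allFin i) fi))

  anyFin⁻ : ∀ {n} (f : Fin n → Bool) → T (anyFin f) → ∃ λ i → T (f i)
  anyFin⁻ {n} f t = satisfied (any⁻ f (allFin n) (subst T (sym (foldr-map _∨_ f false (allFin n))) t))

  allFin?⁺ : ∀ {n} (f : Fin n → Bool) → (∀ i → T (f i)) → T (allFin? f)
  allFin?⁺ {n} f h =
    subst T (foldr-map _∧_ f true (allFin n)) (all⁻ f (All.tabulate {xs = allFin n} (λ {i} _ → h i)))

  allFin?⁻ : ∀ {n} (f : Fin n → Bool) → T (allFin? f) → ∀ i → T (f i)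
  allFin?⁻ {n} f t i =
    All.lookup (all⁺ f (allFin n) (subst T (sym (foldr-map _∧_ f true (allFin n))) t)) (∈-allFin i)

  sumFin-suc : ∀ {n} (f : Fin (suc n) → ℕ) → sumFin f ≡ f zero + sumFin (f ∘ suc)
  sumFin-suc f = foldr-allFin-suc (λ i s → f i + s) 0

  sumFin-cong : ∀ {n} {f g : Fin n → ℕ} → f ≗ g → sumFin f ≡ sumFin g
  sumFin-cong {zero}          _   = refl
  sumFin-cong {suc n} {f} {g} f≗g rewrite sumFin-suc f | sumFin-suc g =
    cong₂ _+_ (f≗g zero) (sumFin-cong (f≗g ∘ suc))

  sumFin-mono-≤ : ∀ {n} {f g : Fin n → ℕ} → (∀ i → f i ≤ g i) → sumFin f ≤ sumFin g
  sumFin-mono-≤ {zero}          _   = z≤n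
  sumFin-mono-≤ {suc n} {f} {g} f≤g rewrite sumFin-suc f | sumFin-suc g =
    ℕ.+-mono-≤ (f≤g zero) (sumFin-mono-≤ (f≤g ∘ suc))

  sumFin-distrib-+ : ∀ {n} (f g : Fin n → ℕ) → sumFin (λ i → f i + g i) ≡ sumFin f + sumFin g
  sumFin-distrib-+ {zero}  f g = refl
  sumFin-distrib-+ {suc n} f g
    rewrite sumFin-suc (λ i → f i + g i) | sumFin-suc f | sumFin-suc g
          | sumFin-distrib-+ (f ∘ suc) (g ∘ suc) =
    +-interchange (f zero) (g zero) (sumFin (f ∘ suc)) (sumFin (g ∘ suc))

  term≤sumFin : ∀ {n} (f : Fin n → ℕ) i → f i ≤ sumFin f
  term≤sumFin f zero    rewrite sumFin-suc f = ℕ.m≤m+n (f zero) _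
  term≤sumFin f (suc i) rewrite sumFin-suc f = ℕ.m≤n⇒m≤o+n (f zero) (term≤sumFin (f ∘ suc) i)

  sumFin-zero : ∀ n → sumFin {n} (λ _ → 0) ≡ 0
  sumFin-zero zero    = refl
  sumFin-zero (suc n) = trans (sumFin-suc {n} (λ _ → 0)) (sumFin-zero n)

  sumFin-if : ∀ {n} b (f : Fin n → ℕ) →
              sumFin (λ i → if b then f i else 0) ≡ (if b then sumFin f else 0)
  sumFin-if     true  f = refl
  sumFin-if {n} false f = sumFin-zero n

  sumFin-δ : ∀ {n} (f : Fin n → ℕ) v → sumFin (λ u → if ⌊ u ≟ v ⌋ then f u else 0) ≡ f v
  sumFin-δ {suc n} f zero rewrite sumFin-suc (λ u → if ⌊ u ≟ zero {n} ⌋ then f u else 0) =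
    trans (cong (f zero +_) (sumFin-zero n)) (ℕ.+-identityʳ (f zero))
  sumFin-δ {suc n} f (suc v) rewrite sumFin-suc (λ u → if ⌊ u ≟ suc v ⌋ then f u else 0) =
    trans (sumFin-cong suc-δ) (sumFin-δ (f ∘ suc) v)
    where
    suc-δ : ∀ u → (if ⌊ suc u ≟ suc v ⌋ then f (suc u) else 0) ≡
                  (if ⌊ u ≟ v ⌋ then f (suc u) else 0)
    suc-δ u with u ≟ v
    ... | yes _ = refl
    ... | no  _ = refl

  b2n-≤ : ∀ {x y} → (T x → T y) → b2n x ≤ b2n y
  b2n-≤ {false}         _ = z≤n
  b2n-≤ {true}  {true}  _ = s≤s z≤n
  b2n-≤ {true}  {false} h = ⊥-elim (h _)

  b2n-≤-+ : ∀ {x y z} → (T x → T y ⊎ T z) → b2n x ≤ b2n y + b2n z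
  b2n-≤-+ {false} _ = z≤n
  b2n-≤-+ {true} {y} {z} h with h _
  ... | inj₁ ty = ℕ.≤-trans (b2n-≤ {true} {y} (λ _ → ty)) (ℕ.m≤m+n (b2n y) (b2n z))
  ... | inj₂ tz = ℕ.≤-trans (b2n-≤ {true} {z} (λ _ → tz)) (ℕ.m≤n+m (b2n z) (b2n y))

  card : ∀ {n} → (Fin n → Bool) → ℕ
  card X = sumFin (λ u → b2n (X u))

  card-∷ : ∀ {n} (Y : Fin (suc n) → Bool) → card Y ≡ b2n (Y zero) + card (Y ∘ suc)
  card-∷ Y = sumFin-suc (λ u → b2n (Y u))

  card-full : ∀ n → card {n} (λ _ → true) ≡ n
  card-full zero    = refl
  card-full (suc n) = trans (card-∷ {n} (λ _ → true)) (cong suc (card-full n))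

  card-≤ : ∀ {n} (X : Fin n → Bool) → card X ≤ n
  card-≤ {n} X = ℕ.≤-trans (sumFin-mono-≤ (λ u → b2n-≤ {X u} {true} _)) (ℕ.≤-reflexive (card-full n))

  1≤card : ∀ {n} (X : Fin n → Bool) v → T (X v) → 1 ≤ card X
  1≤card X v xv = ℕ.≤-trans (b2n-≤ {true} {X v} (λ _ → xv)) (term≤sumFin (λ u → b2n (X u)) v)

  card-∖ : ∀ {n} (X Y : Fin n → Bool) → (∀ u → T (X u) → T (Y u)) →
           card (λ u → Y u ∧ not (X u)) + card X ≡ card Y
  card-∖ X Y X⊆Y =
    trans (sym (sumFin-distrib-+ (λ u → b2n (Y u ∧ not (X u))) (λ u → b2n (X u)))) (sumFin-cong split)
    where
    split : ∀ u → b2n (Y u ∧ not (X u)) + b2n (X u) ≡ b2n (Y u)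
    split u with X u | Y u | X⊆Y u
    ... | false | y     | _ = trans (ℕ.+-identityʳ (b2n (y ∧ true))) (cong b2n (∧-identityʳ y))
    ... | true  | true  | _ = refl
    ... | true  | false | h = ⊥-elim (h _)

  card-< : ∀ {n} (X Y : Fin n → Bool) v → (∀ u → T (X u) → T (Y u)) → T (Y v) → ¬ T (X v) →
           card X < card Y
  card-< X Y v X⊆Y yv ¬xv = ℕ.≤-trans
    (ℕ.+-monoˡ-≤ (card X) (1≤card (λ u → Y u ∧ not (X u)) v (T-∧⁺ yv (T-not⁺ ¬xv))))
    (ℕ.≤-reflexive (card-∖ X Y X⊆Y))

  *-card≤sumFin : ∀ {n} (X : Fin n → Bool) (f : Fin n → ℕ) d →
                  (∀ u → T (X u) → d ≤ f u) → d * card X ≤ sumFin f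
  *-card≤sumFin {zero}  X f d _ = ℕ.≤-reflexive (ℕ.*-zeroʳ d)
  *-card≤sumFin {suc n} X f d d≤f
    rewrite card-∷ X | sumFin-suc f | ℕ.*-distribˡ-+ d (b2n (X zero)) (card (X ∘ suc)) =
    ℕ.+-mono-≤ (*-b2n≤ (X zero) (d≤f zero)) (*-card≤sumFin (X ∘ suc) (f ∘ suc) d (d≤f ∘ suc))
    where
    *-b2n≤ : ∀ {m} x → (T x → d ≤ m) → d * b2n x ≤ m
    *-b2n≤ true  h = ℕ.≤-trans (ℕ.≤-reflexive (ℕ.*-identityʳ d)) (h _)
    *-b2n≤ false _ = ℕ.≤-trans (ℕ.≤-reflexive (ℕ.*-zeroʳ d)) z≤n

  lookup⇒1≤∣∣ : ∀ {n} (S : Subset n) v → T (lookup S v) → 1 ≤ ∣ S ∣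
  lookup⇒1≤∣∣ (true  ∷ S) v       _ = s≤s z≤n
  lookup⇒1≤∣∣ (false ∷ S) (suc v) t = lookup⇒1≤∣∣ S v t

  ∣∣≤1-unique : ∀ {n} (S : Subset n) u v → ∣ S ∣ ≤ 1 → T (lookup S u) → T (lookup S v) → u ≡ v
  ∣∣≤1-unique (true  ∷ S) zero    zero    _           _  _  = refl
  ∣∣≤1-unique (true  ∷ S) zero    (suc v) (s≤s ∣S∣≤0) _  sv =
    contradiction (ℕ.≤-trans (lookup⇒1≤∣∣ S v sv) ∣S∣≤0) λ ()
  ∣∣≤1-unique (true  ∷ S) (suc u) _       (s≤s ∣S∣≤0) su _  =
    contradiction (ℕ.≤-trans (lookup⇒1≤∣∣ S u su) ∣S∣≤0) λ ()
  ∣∣≤1-unique (false ∷ S) (suc u) (suc v) ∣S∣≤1       su sv = cong suc (∣∣≤1-unique S u v ∣S∣≤1 su sv)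

  1≤∣∣⇒lookup : ∀ {n} (S : Subset n) → 1 ≤ ∣ S ∣ → ∃ λ u → T (lookup S u)
  1≤∣∣⇒lookup (true  ∷ S) _     = zero , _
  1≤∣∣⇒lookup (false ∷ S) 1≤∣S∣ = let u , su = 1≤∣∣⇒lookup S 1≤∣S∣ in suc u , su

  2≤∣∣⇒other : ∀ {n} (S : Subset n) v → 2 ≤ ∣ S ∣ → T (lookup S v) → ∃ λ u → u ≢ v × T (lookup S u)
  2≤∣∣⇒other (true  ∷ S) zero    (s≤s 1≤∣S∣) _ = let u , su = 1≤∣∣⇒lookup S 1≤∣S∣ in suc u , (λ ()) , su
  2≤∣∣⇒other (true  ∷ S) (suc v) _           _ = zero , (λ ()) , _
  2≤∣∣⇒other (false ∷ S) (suc v) 2≤∣S∣       sv =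
    let u , u≢v , su = 2≤∣∣⇒other S v 2≤∣S∣ sv in suc u , u≢v ∘ suc-injective , su

  _⊆ᵇ_ : ∀ {n} → Subset n → (Fin n → Bool) → Bool
  S ⊆ᵇ Y = allFin? (λ u → not (lookup S u) ∨ Y u)

  ⊆ᵇ⁺ : ∀ {n} (S : Subset n) Y → (∀ u → T (lookup S u) → T (Y u)) → T (S ⊆ᵇ Y)
  ⊆ᵇ⁺ S Y S⊆Y = allFin?⁺ _ member
    where
    member : ∀ u → T (not (lookup S u) ∨ Y u)
    member u with T? (lookup S u)
    ... | yes su = T-∨⁺ʳ {not (lookup S u)} (S⊆Y u su)
    ... | no ¬su = T-∨⁺ˡ (T-not⁺ ¬su)

  ⊆ᵇ⁻ : ∀ {n} (S : Subset n) Y → T (S ⊆ᵇ Y) → ∀ u → T (lookup S u) → T (Y u)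
  ⊆ᵇ⁻ S Y S⊆Y u su with T-∨⁻ (allFin?⁻ _ S⊆Y u)
  ... | inj₁ ¬su = contradiction su (T-not⁻ ¬su)
  ... | inj₂ yu  = yu

  ∷-⊆ᵇ : ∀ {n} b (S : Subset n) Y → (b ∷ S) ⊆ᵇ Y ≡ (not b ∨ Y zero) ∧ S ⊆ᵇ (Y ∘ suc)
  ∷-⊆ᵇ b S Y = foldr-allFin-suc (λ u c → (not (lookup (b ∷ S) u) ∨ Y u) ∧ c) true

  -- Counting subsets by size

  countIn : ∀ {n} → ℕ → (Subset n → Bool) → List (Subset n) → ℕ
  countIn r P = foldr (λ S c → b2n (P S ∧ (∣ S ∣ ≡ᵇ r)) + c) 0

  count : ∀ n → ℕ → (Subset n → Bool) → ℕ
  count n r P = countIn r P (subsets n)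

  module _ {n : ℕ} (r : ℕ) where

    countIn-++ : ∀ (P : Subset n → Bool) (L M : List (Subset n)) →
                 countIn r P (L ++ M) ≡ countIn r P L + countIn r P M
    countIn-++ P []      M = refl
    countIn-++ P (S ∷ L) M =
      trans (cong (b2n (P S ∧ (∣ S ∣ ≡ᵇ r)) +_) (countIn-++ P L M))
            (sym (ℕ.+-assoc (b2n (P S ∧ (∣ S ∣ ≡ᵇ r))) (countIn r P L) (countIn r P M)))

    countIn-mono : ∀ {P Q : Subset n → Bool} → (∀ S → ∣ S ∣ ≡ r → T (P S) → T (Q S)) →
                   ∀ L → countIn r P L ≤ countIn r Q L
    countIn-mono         P⊆Q []      = z≤n
    countIn-mono {P} {Q} P⊆Q (S ∷ L) = ℕ.+-mono-≤ (b2n-≤ here) (countIn-mono P⊆Q L)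
      where
      here : T (P S ∧ (∣ S ∣ ≡ᵇ r)) → T (Q S ∧ (∣ S ∣ ≡ᵇ r))
      here t = T-∧⁺ (P⊆Q S (ℕ.≡ᵇ⇒≡ ∣ S ∣ r ∣S∣≡r) (T-∧⁻ˡ t)) ∣S∣≡r
        where ∣S∣≡r = T-∧⁻ʳ {P S} t

    countIn-≤-+ : ∀ {P Q R : Subset n → Bool} → (∀ S → ∣ S ∣ ≡ r → T (P S) → T (Q S) ⊎ T (R S)) → ∀ L →
                  countIn r P L ≤ countIn r Q L + countIn r R L
    countIn-≤-+             P⊆Q∪R []      = z≤n
    countIn-≤-+ {P} {Q} {R} P⊆Q∪R (S ∷ L) = ℕ.≤-trans
      (ℕ.+-mono-≤ (b2n-≤-+ here) (countIn-≤-+ P⊆Q∪R L))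
      (ℕ.≤-reflexive (+-interchange (b2n (Q S ∧ (∣ S ∣ ≡ᵇ r))) (b2n (R S ∧ (∣ S ∣ ≡ᵇ r)))
                                    (countIn r Q L) (countIn r R L)))
      where
      here : T (P S ∧ (∣ S ∣ ≡ᵇ r)) → T (Q S ∧ (∣ S ∣ ≡ᵇ r)) ⊎ T (R S ∧ (∣ S ∣ ≡ᵇ r))
      here t with P⊆Q∪R S (ℕ.≡ᵇ⇒≡ ∣ S ∣ r (T-∧⁻ʳ {P S} t)) (T-∧⁻ˡ t)
      ... | inj₁ q = inj₁ (T-∧⁺ q (T-∧⁻ʳ {P S} t))
      ... | inj₂ s = inj₂ (T-∧⁺ s (T-∧⁻ʳ {P S} t))

    countIn-split : ∀ (P Q : Subset n → Bool) L →
                    countIn r P L ≡ countIn r (λ S → P S ∧ Q S) L + countIn r (λ S → P S ∧ not (Q S)) L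
    countIn-split P Q []      = refl
    countIn-split P Q (S ∷ L) rewrite countIn-split P Q L with P S | Q S | ∣ S ∣ ≡ᵇ r
    ... | false | _     | _     = refl
    ... | true  | true  | false = refl
    ... | true  | false | false = refl
    ... | true  | true  | true  = refl
    ... | true  | false | true  =
      sym (ℕ.+-suc (countIn r (λ S → P S ∧ Q S) L) (countIn r (λ S → P S ∧ not (Q S)) L))

    countIn-cong : ∀ {P Q : Subset n → Bool} → (∀ S → P S ≡ Q S) → ∀ L → countIn r P L ≡ countIn r Q L
    countIn-cong         P≗Q []      = refl
    countIn-cong {P} {Q} P≗Q (S ∷ L) rewrite P≗Q S = cong (b2n (Q S ∧ (∣ S ∣ ≡ᵇ r)) +_) (countIn-cong P≗Q L)

    countIn-false : ∀ (L : List (Subset n)) → countIn r (λ _ → false) L ≡ 0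
    countIn-false []      = refl
    countIn-false (_ ∷ L) = countIn-false L

    countIn-none : ∀ {P : Subset n → Bool} → (∀ S → ∣ S ∣ ≡ r → ¬ T (P S)) → ∀ L → countIn r P L ≡ 0
    countIn-none ¬P L = ℕ.n≤0⇒n≡0 (ℕ.≤-trans (countIn-mono {Q = λ _ → false} ¬P L)
                                              (ℕ.≤-reflexive (countIn-false L)))

    countIn-∧ˡ : ∀ b (P : Subset n → Bool) L →
                 countIn r (λ S → b ∧ P S) L ≡ (if b then countIn r P L else 0)
    countIn-∧ˡ true  P L = refl
    countIn-∧ˡ false P L = countIn-false L

  countIn-map-true∷ : ∀ {n} r (P : Subset (suc n) → Bool) (L : List (Subset n)) →
                      countIn (suc r) P (map (true ∷_) L) ≡ countIn r (P ∘ (true ∷_)) L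
  countIn-map-true∷ r P []      = refl
  countIn-map-true∷ r P (S ∷ L) = cong (b2n (P (true ∷ S) ∧ (∣ S ∣ ≡ᵇ r)) +_) (countIn-map-true∷ r P L)

  countIn-map-false∷ : ∀ {n} r (P : Subset (suc n) → Bool) (L : List (Subset n)) →
                       countIn r P (map (false ∷_) L) ≡ countIn r (P ∘ (false ∷_)) L
  countIn-map-false∷ r P []      = refl
  countIn-map-false∷ r P (S ∷ L) = cong (b2n (P (false ∷ S) ∧ (∣ S ∣ ≡ᵇ r)) +_) (countIn-map-false∷ r P L)

  countIn-map-true∷-zero : ∀ {n} (P : Subset (suc n) → Bool) (L : List (Subset n)) →
                           countIn 0 P (map (true ∷_) L) ≡ 0
  countIn-map-true∷-zero P []      = refl
  countIn-map-true∷-zero P (S ∷ L) rewrite ∧-zeroʳ (P (true ∷ S)) = countIn-map-true∷-zero P L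

  count-suc-zero : ∀ n P → count (suc n) 0 P ≡ count n 0 (P ∘ (false ∷_))
  count-suc-zero n P = trans (countIn-++ 0 P (map (true ∷_) (subsets n)) _)
    (cong₂ _+_ (countIn-map-true∷-zero P (subsets n)) (countIn-map-false∷ 0 P (subsets n)))

  count-suc : ∀ n r P →
              count (suc n) (suc r) P ≡ count n r (P ∘ (true ∷_)) + count n (suc r) (P ∘ (false ∷_))
  count-suc n r P = trans (countIn-++ (suc r) P (map (true ∷_) (subsets n)) _)
    (cong₂ _+_ (countIn-map-true∷ r P (subsets n)) (countIn-map-false∷ (suc r) P (subsets n)))

  count-⊆ : ∀ n (Y : Fin n → Bool) j → count n j (_⊆ᵇ Y) ≡ card Y C j
  count-⊆ zero    Y zero    = refl
  count-⊆ zero    Y (suc j) = refl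
  count-⊆ (suc n) Y zero    = begin
    count (suc n) 0 (_⊆ᵇ Y)              ≡⟨ count-suc-zero n (_⊆ᵇ Y) ⟩
    count n 0 (λ S → (false ∷ S) ⊆ᵇ Y)   ≡⟨ countIn-cong 0 (λ S → ∷-⊆ᵇ false S Y) (subsets n) ⟩
    count n 0 (_⊆ᵇ (Y ∘ suc))            ≡⟨ count-⊆ n (Y ∘ suc) 0 ⟩
    1                                    ∎
    where open ≡-Reasoning
  count-⊆ (suc n) Y (suc j) = begin
    count (suc n) (suc j) (_⊆ᵇ Y)
      ≡⟨ count-suc n j (_⊆ᵇ Y) ⟩
    count n j (λ S → (true ∷ S) ⊆ᵇ Y) + count n (suc j) (λ S → (false ∷ S) ⊆ᵇ Y)
      ≡⟨ cong₂ _+_ (countIn-cong j (λ S → ∷-⊆ᵇ true S Y) (subsets n))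
                   (countIn-cong (suc j) (λ S → ∷-⊆ᵇ false S Y) (subsets n)) ⟩
    count n j (λ S → Y zero ∧ S ⊆ᵇ (Y ∘ suc)) + count n (suc j) (_⊆ᵇ (Y ∘ suc))
      ≡⟨ cong₂ _+_ (countIn-∧ˡ j (Y zero) (_⊆ᵇ (Y ∘ suc)) (subsets n)) (count-⊆ n (Y ∘ suc) (suc j)) ⟩
    (if Y zero then count n j (_⊆ᵇ (Y ∘ suc)) else 0) + card (Y ∘ suc) C suc j
      ≡⟨ cong (λ c → (if Y zero then c else 0) + card (Y ∘ suc) C suc j) (count-⊆ n (Y ∘ suc) j) ⟩
    (if Y zero then card (Y ∘ suc) C j else 0) + card (Y ∘ suc) C suc j
      ≡⟨ pascal (Y zero) ⟩
    (b2n (Y zero) + card (Y ∘ suc)) C suc j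
      ≡⟨ cong (_C suc j) (card-∷ Y) ⟨
    card Y C suc j ∎
    where
    open ≡-Reasoning
    pascal : ∀ b → (if b then card (Y ∘ suc) C j else 0) + card (Y ∘ suc) C suc j ≡
                   (b2n b + card (Y ∘ suc)) C suc j
    pascal true  = nCk+nC[k+1]≡[n+1]C[k+1] (card (Y ∘ suc)) j
    pascal false = refl

  count-∋-⊆ : ∀ n (Y : Fin n → Bool) v → T (Y v) → ∀ j →
              count n (suc j) (λ S → lookup S v ∧ S ⊆ᵇ Y) ≡ (card Y ∸ 1) C j
  count-∋-⊆ (suc n) Y zero y0 j = begin
    count (suc n) (suc j) (λ S → lookup S zero ∧ S ⊆ᵇ Y)
      ≡⟨ count-suc n j (λ S → lookup S zero ∧ S ⊆ᵇ Y) ⟩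
    count n j (λ S → (true ∷ S) ⊆ᵇ Y) + count n (suc j) (λ _ → false)
      ≡⟨ cong₂ _+_ (countIn-cong j (λ S → ∷-⊆ᵇ true S Y) (subsets n)) (countIn-false (suc j) (subsets n)) ⟩
    count n j (λ S → Y zero ∧ S ⊆ᵇ (Y ∘ suc)) + 0
      ≡⟨ ℕ.+-identityʳ _ ⟩
    count n j (λ S → Y zero ∧ S ⊆ᵇ (Y ∘ suc))
      ≡⟨ cong (λ b → count n j (λ S → b ∧ S ⊆ᵇ (Y ∘ suc))) Y0≡true ⟩
    count n j (_⊆ᵇ (Y ∘ suc))
      ≡⟨ count-⊆ n (Y ∘ suc) j ⟩
    (b2n true + card (Y ∘ suc) ∸ 1) C j
      ≡⟨ cong (λ b → (b2n b + card (Y ∘ suc) ∸ 1) C j) Y0≡true ⟨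
    (b2n (Y zero) + card (Y ∘ suc) ∸ 1) C j
      ≡⟨ cong (λ c → (c ∸ 1) C j) (card-∷ Y) ⟨
    (card Y ∸ 1) C j ∎
    where
    open ≡-Reasoning
    Y0≡true : Y zero ≡ true
    Y0≡true = Equivalence.to T-≡ y0
  count-∋-⊆ (suc n) Y (suc v) yv j = begin
    count (suc n) (suc j) (λ S → lookup S (suc v) ∧ S ⊆ᵇ Y)
      ≡⟨ count-suc n j (λ S → lookup S (suc v) ∧ S ⊆ᵇ Y) ⟩
    count n j (λ S → lookup S v ∧ (true ∷ S) ⊆ᵇ Y) + count n (suc j) (λ S → lookup S v ∧ (false ∷ S) ⊆ᵇ Y)
      ≡⟨ cong₂ _+_
           (countIn-cong j (λ S → trans (cong (lookup S v ∧_) (∷-⊆ᵇ true S Y))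
                                        (∧-left-comm (lookup S v) (Y zero) (S ⊆ᵇ (Y ∘ suc)))) (subsets n))
           (countIn-cong (suc j) (λ S → cong (lookup S v ∧_) (∷-⊆ᵇ false S Y)) (subsets n)) ⟩
    count n j (λ S → Y zero ∧ (lookup S v ∧ S ⊆ᵇ (Y ∘ suc))) +
    count n (suc j) (λ S → lookup S v ∧ S ⊆ᵇ (Y ∘ suc))
      ≡⟨ cong₂ _+_ (countIn-∧ˡ j (Y zero) _ (subsets n)) (count-∋-⊆ n (Y ∘ suc) v yv j) ⟩
    (if Y zero then count n j (λ S → lookup S v ∧ S ⊆ᵇ (Y ∘ suc)) else 0) + (c ∸ 1) C j
      ≡⟨ pascal (Y zero) j ⟩
    (b2n (Y zero) + c ∸ 1) C j
      ≡⟨ cong (λ c → (c ∸ 1) C j) (card-∷ Y) ⟨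
    (card Y ∸ 1) C j ∎
    where
    open ≡-Reasoning
    c : ℕ
    c = card (Y ∘ suc)
    pascal : ∀ b j → (if b then count n j (λ S → lookup S v ∧ S ⊆ᵇ (Y ∘ suc)) else 0) + (c ∸ 1) C j
                     ≡ (b2n b + c ∸ 1) C j
    pascal false j       = refl
    pascal true  zero    = cong (_+ 1) (countIn-none 0 (λ S ∣S∣≡0 t →
                             ℕ.<-irrefl (sym ∣S∣≡0) (lookup⇒1≤∣∣ S v (T-∧⁻ˡ t))) (subsets n))
    pascal true  (suc j) = begin
      count n (suc j) (λ S → lookup S v ∧ S ⊆ᵇ (Y ∘ suc)) + (c ∸ 1) C suc j
        ≡⟨ cong (_+ (c ∸ 1) C suc j) (count-∋-⊆ n (Y ∘ suc) v yv j) ⟩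
      (c ∸ 1) C j + (c ∸ 1) C suc j
        ≡⟨ nCk+nC[k+1]≡[n+1]C[k+1] (c ∸ 1) j ⟩
      suc (c ∸ 1) C suc j
        ≡⟨ cong (_C suc j) (ℕ.m+[n∸m]≡n (1≤card (Y ∘ suc) v yv)) ⟩
      c C suc j ∎

  C-mono-≤ : ∀ {m n} k → m ≤ n → m C k ≤ n C k
  C-mono-≤ {n = zero}  k z≤n   = ℕ.≤-refl
  C-mono-≤ {n = suc n} k m≤1+n with ℕ.m≤n⇒m<n∨m≡n m≤1+n
  ... | inj₂ refl  = ℕ.≤-refl
  ... | inj₁ m<1+n = ℕ.≤-trans (C-mono-≤ k (s≤s⁻¹ m<1+n)) (C-suc k)
    where
    C-suc : ∀ k → n C k ≤ suc n C k
    C-suc zero    = ℕ.≤-refl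
    C-suc (suc k) = ℕ.≤-trans (ℕ.m≤n+m (n C suc k) (n C k)) (ℕ.≤-reflexive (nCk+nC[k+1]≡[n+1]C[k+1] n k))

  -- The increments of n ↦ n C k grow: C(a + t) - C(a) ≤ C(a + d + t) - C(a + d).
  C-increments-mono : ∀ a d t k → (a + t) C k + (a + d) C k ≤ (a + d + t) C k + a C k
  C-increments-mono a d zero    k rewrite ℕ.+-identityʳ a | ℕ.+-identityʳ (a + d) =
    ℕ.≤-reflexive (ℕ.+-comm (a C k) ((a + d) C k))
  C-increments-mono a d (suc t) zero    = ℕ.≤-refl
  C-increments-mono a d (suc t) (suc k) rewrite ℕ.+-suc a t | ℕ.+-suc (a + d) t = begin
    suc (a + t) C suc k + (a + d) C suc k
      ≡⟨ cong (_+ (a + d) C suc k) (nCk+nC[k+1]≡[n+1]C[k+1] (a + t) k) ⟨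
    (a + t) C k + (a + t) C suc k + (a + d) C suc k
      ≡⟨ ℕ.+-assoc ((a + t) C k) _ _ ⟩
    (a + t) C k + ((a + t) C suc k + (a + d) C suc k)
      ≤⟨ ℕ.+-mono-≤ (C-mono-≤ k (ℕ.+-monoˡ-≤ t (ℕ.m≤m+n a d))) (C-increments-mono a d t (suc k)) ⟩
    (a + d + t) C k + ((a + d + t) C suc k + a C suc k)
      ≡⟨ ℕ.+-assoc ((a + d + t) C k) _ _ ⟨
    (a + d + t) C k + (a + d + t) C suc k + a C suc k
      ≡⟨ cong (_+ a C suc k) (nCk+nC[k+1]≡[n+1]C[k+1] (a + d + t) k) ⟩
    suc (a + d + t) C suc k + a C suc k ∎
    where open ℕ.≤-Reasoning

  C-increments-mono-∸ : ∀ {x′ d N} j → 1 ≤ x′ → x′ + d ≤ N →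
            (N ∸ d ∸ 1) C j + (x′ + d ∸ 1) C j ≤ (N ∸ 1) C j + (x′ ∸ 1) C j
  C-increments-mono-∸ {suc a} {d} j _ x′+d≤N with ℕ.m≤n⇒∃[o]m+o≡n x′+d≤N
  ... | t , refl = subst (λ m → m C j + (a + d) C j ≤ (a + d + t) C j + a C j)
                         (sym N∸d∸1≡a+t) (C-increments-mono a d t j)
    where
    N∸d∸1≡a+t : suc a + d + t ∸ d ∸ 1 ≡ a + t
    N∸d∸1≡a+t = begin
      suc a + d + t ∸ d ∸ 1     ≡⟨ ℕ.∸-+-assoc (suc a + d + t) d 1 ⟩
      suc a + d + t ∸ (d + 1)   ≡⟨ cong (_∸ (d + 1)) (rearrange a d t) ⟩
      a + t + (d + 1) ∸ (d + 1) ≡⟨ ℕ.m+n∸n≡m (a + t) (d + 1) ⟩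
      a + t                     ∎
      where
      open ≡-Reasoning
      rearrange : ∀ a d t → suc a + d + t ≡ a + t + (d + 1)
      rearrange = solve-∀

  -- Walks and strongly connected sets

  module _ {n} (G : Digraph n) (S : Subset n) where

    walk-source : ∀ k a b → T (walkWithin G S k a b) → T (lookup S a)
    walk-source zero    a b w = T-∧⁻ˡ w
    walk-source (suc k) a b w with T-∨⁻ {walkWithin G S k a b} w
    ... | inj₁ w′   = walk-source k a b w′
    ... | inj₂ step = T-∧⁻ˡ step

    walk-refl : ∀ k a → T (lookup S a) → T (walkWithin G S k a a)
    walk-refl zero    a sa = T-∧⁺ sa (T-≟-refl a)
    walk-refl (suc k) a sa = T-∨⁺ˡ (walk-refl k a sa)

    walk-∷ : ∀ k a c b → T (lookup S a) → T (arc G a c) → T (walkWithin G S k c b) →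
             T (walkWithin G S (suc k) a b)
    walk-∷ k a c b sa ac cb = T-∨⁺ʳ {walkWithin G S k a b}
      (T-∧⁺ sa (anyFin⁺ (λ c → arc G a c ∧ walkWithin G S k c b) c (T-∧⁺ ac cb)))

    walk-≤ : ∀ {j k} a b → j ≤ k → T (walkWithin G S j a b) → T (walkWithin G S k a b)
    walk-≤ {k = zero}  a b z≤n w = w
    walk-≤ {k = suc k} a b j≤k w with ℕ.m≤n⇒m<n∨m≡n j≤k
    ... | inj₁ j<1+k = T-∨⁺ˡ (walk-≤ a b (s≤s⁻¹ j<1+k) w)
    ... | inj₂ refl  = w

    walk-lastArc : ∀ k a b → a ≢ b → T (walkWithin G S k a b) → ∃ λ c → T (lookup S c) × T (arc G c b)
    walk-lastArc zero    a b a≢b w = contradiction (T-≟⁻ (T-∧⁻ʳ {lookup S a} w)) a≢b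
    walk-lastArc (suc k) a b a≢b w with T-∨⁻ {walkWithin G S k a b} w
    ... | inj₁ w′   = walk-lastArc k a b a≢b w′
    ... | inj₂ step with anyFin⁻ _ (T-∧⁻ʳ {lookup S a} step)
    ... | c , ac∧cb with c ≟ b
    ...   | yes refl = a , T-∧⁻ˡ step , T-∧⁻ˡ ac∧cb
    ...   | no  c≢b  = walk-lastArc k c b c≢b (T-∧⁻ʳ {arc G a c} ac∧cb)

    walk-firstArc : ∀ k a b → a ≢ b → T (walkWithin G S k a b) → ∃ λ c → T (lookup S c) × T (arc G a c)
    walk-firstArc zero    a b a≢b w = contradiction (T-≟⁻ (T-∧⁻ʳ {lookup S a} w)) a≢b
    walk-firstArc (suc k) a b a≢b w with T-∨⁻ {walkWithin G S k a b} w
    ... | inj₁ w′   = walk-firstArc k a b a≢b w′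
    ... | inj₂ step =
      let c , ac∧cb = anyFin⁻ _ (T-∧⁻ʳ {lookup S a} step)
      in c , walk-source k c b (T-∧⁻ʳ {arc G a c} ac∧cb) , T-∧⁻ˡ ac∧cb

  walk-mono : ∀ {n} (G H : Digraph n) S →
              (∀ a b → T (lookup S a) → T (lookup S b) → T (arc G a b) → T (arc H a b)) →
              ∀ k a b → T (walkWithin G S k a b) → T (walkWithin H S k a b)
  walk-mono G H S G⊆H zero    a b w = w
  walk-mono G H S G⊆H (suc k) a b w with T-∨⁻ {walkWithin G S k a b} w
  ... | inj₁ w′   = T-∨⁺ˡ (walk-mono G H S G⊆H k a b w′)
  ... | inj₂ step =
    let sa = T-∧⁻ˡ step
        c , ac∧cb = anyFin⁻ _ (T-∧⁻ʳ {lookup S a} step)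
        cb = T-∧⁻ʳ {arc G a c} ac∧cb
    in walk-∷ H S k a c b sa (G⊆H a c sa (walk-source G S k c b cb) (T-∧⁻ˡ ac∧cb))
              (walk-mono G H S G⊆H k c b cb)

  strongSet : ∀ {n} → Digraph n → Subset n → Bool
  strongSet G S = nonempty S ∧ inducesStronglyConnected G S

  module _ {n} (G : Digraph n) (S : Subset n) where

    strongSet⁺ : T (nonempty S) →
                 (∀ u v → T (lookup S u) → T (lookup S v) → T (walkWithin G S n u v)) →
                 T (strongSet G S)
    strongSet⁺ ne walks = T-∧⁺ ne (allFin?⁺ _ λ u → allFin?⁺ _ λ v → pair u v)
      where
      pair : ∀ u v → T (not (lookup S u ∧ lookup S v) ∨ walkWithin G S n u v)
      pair u v with T? (lookup S u ∧ lookup S v)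
      ... | yes su∧sv =
        T-∨⁺ʳ {not (lookup S u ∧ lookup S v)} (walks u v (T-∧⁻ˡ su∧sv) (T-∧⁻ʳ {lookup S u} su∧sv))
      ... | no ¬su∧sv = T-∨⁺ˡ (T-not⁺ ¬su∧sv)

    strongSet-walk : T (strongSet G S) → ∀ u v → T (lookup S u) → T (lookup S v) → T (walkWithin G S n u v)
    strongSet-walk sc u v su sv with T-∨⁻ (allFin?⁻ _ (allFin?⁻ _ (T-∧⁻ʳ {nonempty S} sc) u) v)
    ... | inj₁ ¬su∧sv = contradiction (T-∧⁺ su sv) (T-not⁻ ¬su∧sv)
    ... | inj₂ walk   = walk

    strongSet-≤1 : T (nonempty S) → ∣ S ∣ ≤ 1 → T (strongSet G S)
    strongSet-≤1 ne ∣S∣≤1 = strongSet⁺ ne λ u v su sv →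
      subst (λ v → T (walkWithin G S n u v)) (∣∣≤1-unique S u v ∣S∣≤1 su sv) (walk-refl G S n u su)

    strongSet-inArc : T (strongSet G S) → 2 ≤ ∣ S ∣ → ∀ v → T (lookup S v) →
                      ∃ λ u → T (lookup S u) × T (arc G u v)
    strongSet-inArc sc 2≤∣S∣ v sv =
      let u , u≢v , su = 2≤∣∣⇒other S v 2≤∣S∣ sv
      in walk-lastArc G S n u v u≢v (strongSet-walk sc u v su sv)

    strongSet-outArc : T (strongSet G S) → 2 ≤ ∣ S ∣ → ∀ v → T (lookup S v) →
                       ∃ λ u → T (lookup S u) × T (arc G v u)
    strongSet-outArc sc 2≤∣S∣ v sv =
      let u , u≢v , su = 2≤∣∣⇒other S v 2≤∣S∣ sv
      in walk-firstArc G S n v u (u≢v ∘ sym) (strongSet-walk sc v u sv su)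

  strongSet-mono : ∀ {n} (G H : Digraph n) S →
                   (∀ a b → T (lookup S a) → T (lookup S b) → T (arc G a b) → T (arc H a b)) →
                   T (strongSet G S) → T (strongSet H S)
  strongSet-mono {n} G H S G⊆H sc = strongSet⁺ H S (T-∧⁻ˡ sc) λ u v su sv →
    walk-mono G H S G⊆H n u v (strongSet-walk G S sc u v su sv)

  strongSet-D : ∀ k (S : Subset (3 + k)) → T (lookup S zero) → T (strongSet (D k) S)
  strongSet-D k S s0 = strongSet⁺ (D k) S (anyFin⁺ (lookup S) zero s0) walk
    where
    walk : ∀ u v → T (lookup S u) → T (lookup S v) → T (walkWithin (D k) S (3 + k) u v)
    walk zero    zero    _  _  = walk-refl (D k) S (3 + k) zero s0
    walk zero    (suc v) _  sv = walk-≤ (D k) S {1} {3 + k} zero (suc v) (s≤s z≤n)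
      (walk-∷ (D k) S 0 zero (suc v) (suc v) s0 _ (walk-refl (D k) S 0 (suc v) sv))
    walk (suc u) zero    su _  = walk-≤ (D k) S {1} {3 + k} (suc u) zero (s≤s z≤n)
      (walk-∷ (D k) S 0 (suc u) zero zero su _ (walk-refl (D k) S 0 zero s0))
    walk (suc u) (suc v) su sv = walk-≤ (D k) S {2} {3 + k} (suc u) (suc v) (s≤s (s≤s z≤n))
      (walk-∷ (D k) S 1 (suc u) zero (suc v) su _
        (walk-∷ (D k) S 0 zero (suc v) (suc v) s0 _ (walk-refl (D k) S 0 (suc v) sv)))

  nonIsolated : ∀ {n} → Digraph n → Fin n → Bool
  nonIsolated G u = anyFin (λ w → arc G u w ∨ arc G w u)

  indeg outdeg : ∀ {n} → Digraph n → Fin n → ℕ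
  indeg  G v = card (λ u → arc G u v)
  outdeg G v = card (arc G v)

  strongSet-nonIsolated : ∀ {n} (G : Digraph n) S → T (strongSet G S) → 2 ≤ ∣ S ∣ →
                          ∀ u → T (lookup S u) → T (nonIsolated G u)
  strongSet-nonIsolated G S sc 2≤∣S∣ u su =
    let w , _ , wu = strongSet-inArc G S sc 2≤∣S∣ u su
    in anyFin⁺ _ w (T-∨⁺ʳ {arc G u w} wu)

  1≤deg : ∀ {n} (G : Digraph n) v → T (nonIsolated G v) → 1 ≤ indeg G v + outdeg G v
  1≤deg G v t with anyFin⁻ _ t
  ... | w , vw∨wv with T-∨⁻ {arc G v w} vw∨wv
  ... | inj₁ vw = ℕ.m≤n⇒m≤o+n (indeg G v) (1≤card (arc G v) w vw)
  ... | inj₂ wv = ℕ.m≤n⇒m≤n+o (outdeg G v) (1≤card (λ u → arc G u v) w wv)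

  -- The paper's G - v, kept on the same vertex set: all arcs at v are deleted.
  isolate : ∀ {n} → Digraph n → Fin n → Digraph n
  isolate G v = record
    { arc      = λ a b → arc G a b ∧ not ⌊ a ≟ v ⌋ ∧ not ⌊ b ≟ v ⌋
    ; loopless = λ a → cong (_∧ (not ⌊ a ≟ v ⌋ ∧ not ⌊ a ≟ v ⌋)) (loopless G a)
    }

  module _ {n} (G : Digraph n) (v : Fin n) where

    nonIsolated-isolate : ∀ u → T (nonIsolated (isolate G v) u) → T (nonIsolated G u)
    nonIsolated-isolate u t with anyFin⁻ _ t
    ... | w , uw∨wu with T-∨⁻ {arc (isolate G v) u w} uw∨wu
    ... | inj₁ uw = anyFin⁺ _ w (T-∨⁺ˡ (T-∧⁻ˡ {arc G u w} uw))
    ... | inj₂ wu = anyFin⁺ _ w (T-∨⁺ʳ {arc G u w} (T-∧⁻ˡ wu))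

    ¬nonIsolated-isolate : ¬ T (nonIsolated (isolate G v) v)
    ¬nonIsolated-isolate t with anyFin⁻ _ t
    ... | w , vw∨wv with T-∨⁻ {arc (isolate G v) v w} vw∨wv
    ... | inj₁ vw = T-not⁻ (T-∧⁻ˡ (T-∧⁻ʳ {arc G v w} vw)) (T-≟-refl v)
    ... | inj₂ wv = T-not⁻ (T-∧⁻ʳ {not ⌊ w ≟ v ⌋} (T-∧⁻ʳ {arc G w v} wv)) (T-≟-refl v)

    strongSet-isolate : ∀ S → ¬ T (lookup S v) → T (strongSet G S) → T (strongSet (isolate G v) S)
    strongSet-isolate S v∉S = strongSet-mono G (isolate G v) S λ a b sa sb ab →
      T-∧⁺ ab (T-∧⁺ (T-not⁺ (v∉S ∘ ≟-member sa)) (T-not⁺ (v∉S ∘ ≟-member sb)))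
      where
      ≟-member : ∀ {a} → T (lookup S a) → T ⌊ a ≟ v ⌋ → T (lookup S v)
      ≟-member sa a≟v = subst (T ∘ lookup S) (T-≟⁻ a≟v) sa

    arcCount-isolate : arcCount (isolate G v) + (indeg G v + outdeg G v) ≡ arcCount G
    arcCount-isolate = sym (begin
      arcCount G
        ≡⟨ sumFin-cong (λ u → sumFin-cong (split u)) ⟩
      sumFin (λ u → sumFin (λ w → b2n (arc G′ u w) + (fromV u w + intoV u w)))
        ≡⟨ sumFin-cong (λ u → trans (sumFin-distrib-+ (λ w → b2n (arc G′ u w)) (λ w → fromV u w + intoV u w))
                                    (cong (outdeg G′ u +_) (sumFin-distrib-+ (fromV u) (intoV u)))) ⟩
      sumFin (λ u → outdeg G′ u + (sumFin (fromV u) + sumFin (intoV u)))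
        ≡⟨ trans (sumFin-distrib-+ (outdeg G′) (λ u → sumFin (fromV u) + sumFin (intoV u)))
                 (cong (arcCount G′ +_) (sumFin-distrib-+ (λ u → sumFin (fromV u)) (λ u → sumFin (intoV u)))) ⟩
      arcCount G′ + (sumFin (λ u → sumFin (fromV u)) + sumFin (λ u → sumFin (intoV u)))
        ≡⟨ cong (arcCount G′ +_) (cong₂ _+_
             (trans (sumFin-cong (λ u → sumFin-if ⌊ u ≟ v ⌋ (λ w → b2n (arc G u w)))) (sumFin-δ (outdeg G) v))
             (sumFin-cong (λ u → sumFin-δ (λ w → b2n (arc G u w)) v))) ⟩
      arcCount G′ + (outdeg G v + indeg G v)
        ≡⟨ cong (arcCount G′ +_) (ℕ.+-comm (outdeg G v) (indeg G v)) ⟩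
      arcCount G′ + (indeg G v + outdeg G v) ∎)
      where
      open ≡-Reasoning
      G′ : Digraph n
      G′ = isolate G v
      fromV intoV : Fin n → Fin n → ℕ
      fromV u w = if ⌊ u ≟ v ⌋ then b2n (arc G u w) else 0
      intoV u w = if ⌊ w ≟ v ⌋ then b2n (arc G u w) else 0
      split : ∀ u w → b2n (arc G u w) ≡ b2n (arc G′ u w) + (fromV u w + intoV u w)
      split u w with u ≟ v | w ≟ v
      ... | yes refl | yes refl rewrite loopless G u = refl
      ... | yes refl | no _     rewrite ∧-zeroʳ (arc G u w) = sym (ℕ.+-identityʳ (b2n (arc G u w)))
      ... | no _     | yes refl rewrite ∧-zeroʳ (arc G u w) = refl
      ... | no _     | no _     rewrite ∧-identityʳ (arc G u w) = sym (ℕ.+-identityʳ (b2n (arc G u w)))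

  -- The pivot step

  -- For d ≥ 2 this is (x - 2)(d - 2) ≥ 0 combined with d x < 2N.
  x+d≤1+N : ∀ {m N} d x → m < 2 * N → d * x ≤ m → d < x → x ≤ N → x + d ≤ suc N
  x+d≤1+N 0 x _ _ _ x≤N = ℕ.≤-trans (ℕ.≤-reflexive (ℕ.+-identityʳ x)) (ℕ.m≤n⇒m≤1+n x≤N)
  x+d≤1+N 1 x _ _ _ x≤N = ℕ.≤-trans (ℕ.≤-reflexive (ℕ.+-comm x 1)) (s≤s x≤N)
  x+d≤1+N {m} {N} (suc (suc e)) (suc (suc y)) m<2N dx≤m _ _ = s≤s⁻¹ (ℕ.*-cancelˡ-< 2 _ _ (begin-strict
    2 * (2 + y + (2 + e))           ≤⟨ ℕ.m≤m+n _ (e * y) ⟩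
    2 * (2 + y + (2 + e)) + e * y   ≡⟨ expand e y ⟩
    (2 + e) * (2 + y) + 4           ≤⟨ ℕ.+-monoˡ-≤ 4 dx≤m ⟩
    m + 4                           <⟨ ℕ.+-monoˡ-< 4 m<2N ⟩
    2 * N + 4                       ≡⟨ ℕ.*-distribˡ-+ 2 N 2 ⟨
    2 * (N + 2)                     ≡⟨ cong (2 *_) (ℕ.+-comm N 2) ⟩
    2 * (2 + N)                     ∎))
    where
    open ℕ.≤-Reasoning
    expand : ∀ e y → 2 * (2 + y + (2 + e)) + e * y ≡ (2 + e) * (2 + y) + 4
    expand = solve-∀
  x+d≤1+N (suc (suc e)) 1 _ _ (s≤s ()) _

  minDeg : ∀ {n} → Digraph n → Fin n → ℕ
  minDeg G w = indeg G w ⊓ outdeg G w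

  record Pivot {n} (G : Digraph n) : Set where
    field
      v             : Fin n
      I             : Fin n → Bool
      v-nonIsolated : T (nonIsolated G v)
      I⊆nonIsolated : ∀ u → T (I u) → T (nonIsolated G u)
      v∉I           : ¬ T (I v)
      I-meets       : ∀ S → T (strongSet G S) → 2 ≤ ∣ S ∣ → T (lookup S v) →
                      ∃ λ u → T (lookup S u) × T (I u)
      ∣I∣≤minDeg    : ∀ w → T (nonIsolated G w) → card I ≤ minDeg G w

  module PivotProperties {n} {G : Digraph n} (P : Pivot G) where
    open Pivot P

    X X′ : Fin n → Bool
    X    = nonIsolated G
    X′ u = X u ∧ not (I u)

    G′ : Digraph n
    G′ = isolate G v

    v∈X′ : T (X′ v)
    v∈X′ = T-∧⁺ v-nonIsolated (T-not⁺ v∉I)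

    ∣X′∣+∣I∣≡∣X∣ : card X′ + card I ≡ card X
    ∣X′∣+∣I∣≡∣X∣ = card-∖ I X I⊆nonIsolated

    ∣I∣*∣X∣≤arcCount : card I * card X ≤ arcCount G
    ∣I∣*∣X∣≤arcCount = *-card≤sumFin X (outdeg G) (card I)
      (λ w xw → ℕ.≤-trans (∣I∣≤minDeg w xw) (ℕ.m⊓n≤n (indeg G w) (outdeg G w)))

    2∣I∣≤deg : 2 * card I ≤ indeg G v + outdeg G v
    2∣I∣≤deg = begin
      2 * card I                 ≡⟨ cong (card I +_) (ℕ.+-identityʳ (card I)) ⟩
      card I + card I            ≤⟨ ℕ.+-mono-≤ (ℕ.≤-trans ∣I∣≤minDeg-v (ℕ.m⊓n≤m _ _))
                                               (ℕ.≤-trans ∣I∣≤minDeg-v (ℕ.m⊓n≤n _ _)) ⟩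
      indeg G v + outdeg G v     ∎
      where
      open ℕ.≤-Reasoning
      ∣I∣≤minDeg-v : card I ≤ minDeg G v
      ∣I∣≤minDeg-v = ∣I∣≤minDeg v v-nonIsolated

    arcCount-G′+2∣I∣≤arcCount : arcCount G′ + 2 * card I ≤ arcCount G
    arcCount-G′+2∣I∣≤arcCount =
      ℕ.≤-trans (ℕ.+-monoʳ-≤ (arcCount G′) 2∣I∣≤deg) (ℕ.≤-reflexive (arcCount-isolate G v))

    arcCount-G′<arcCount : arcCount G′ < arcCount G
    arcCount-G′<arcCount =
      ℕ.<-≤-trans (ℕ.m<m+n (arcCount G′) (1≤deg G v v-nonIsolated)) (ℕ.≤-reflexive (arcCount-isolate G v))

    ∣X[G′]∣<∣X∣ : card (nonIsolated G′) < card X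
    ∣X[G′]∣<∣X∣ =
      card-< (nonIsolated G′) X v (nonIsolated-isolate G v) v-nonIsolated (¬nonIsolated-isolate G v)

    -- A strong set either avoids v, or contains v, lies in X and meets I; the sets with
    -- v ∈ S ⊆ X that miss I are exactly those with v ∈ S ⊆ X′.
    pivot-count : ∀ s → count n (2 + s) (strongSet G) + (card X′ ∸ 1) C (1 + s) ≤
                        count n (2 + s) (strongSet G′) + (card X ∸ 1) C (1 + s)
    pivot-count s = begin
      # (strongSet G) + (card X′ ∸ 1) C (1 + s)
        ≤⟨ ℕ.+-mono-≤ (countIn-≤-+ (2 + s) strong⇒ (subsets n))
                      (ℕ.≤-reflexive (sym (count-∋-⊆ n X′ v v∈X′ (1 + s)))) ⟩
      # (strongSet G′) + # (λ S → B S ∧ M S) + # (λ S → lookup S v ∧ S ⊆ᵇ X′)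
        ≤⟨ ℕ.+-monoʳ-≤ _ (countIn-mono (2 + s) (λ S _ → avoid⇒ S) (subsets n)) ⟩
      # (strongSet G′) + # (λ S → B S ∧ M S) + # (λ S → B S ∧ not (M S))
        ≡⟨ ℕ.+-assoc (# (strongSet G′)) _ _ ⟩
      # (strongSet G′) + (# (λ S → B S ∧ M S) + # (λ S → B S ∧ not (M S)))
        ≡⟨ cong (# (strongSet G′) +_) (sym (countIn-split (2 + s) B M (subsets n))) ⟩
      # (strongSet G′) + # B
        ≡⟨ cong (# (strongSet G′) +_) (count-∋-⊆ n X v v-nonIsolated (1 + s)) ⟩
      # (strongSet G′) + (card X ∸ 1) C (1 + s) ∎
      where
      open ℕ.≤-Reasoning
      # : (Subset n → Bool) → ℕ
      # = count n (2 + s)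
      B M : Subset n → Bool
      B S = lookup S v ∧ S ⊆ᵇ X
      M S = anyFin (λ u → lookup S u ∧ I u)

      strong⇒ : ∀ S → ∣ S ∣ ≡ 2 + s → T (strongSet G S) → T (strongSet G′ S) ⊎ T (B S ∧ M S)
      strong⇒ S ∣S∣≡2+s sc with T? (lookup S v)
      ... | no  v∉S = inj₁ (strongSet-isolate G v S v∉S sc)
      ... | yes v∈S =
        let 2≤∣S∣   = ℕ.≤-trans (s≤s (s≤s z≤n)) (ℕ.≤-reflexive (sym ∣S∣≡2+s))
            u , su , iu = I-meets S sc 2≤∣S∣ v∈S
        in inj₂ (T-∧⁺ (T-∧⁺ v∈S (⊆ᵇ⁺ S X (strongSet-nonIsolated G S sc 2≤∣S∣)))
                      (anyFin⁺ _ u (T-∧⁺ su iu)))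

      avoid⇒ : ∀ S → T (lookup S v ∧ S ⊆ᵇ X′) → T (B S ∧ not (M S))
      avoid⇒ S t = T-∧⁺ {B S} (T-∧⁺ v∈S (⊆ᵇ⁺ S X λ u su → T-∧⁻ˡ (S⊆X′ u su))) (T-not⁺ misses)
        where
        v∈S : T (lookup S v)
        v∈S = T-∧⁻ˡ t
        S⊆X′ : ∀ u → T (lookup S u) → T (X′ u)
        S⊆X′ = ⊆ᵇ⁻ S X′ (T-∧⁻ʳ {lookup S v} t)
        misses : ¬ T (M S)
        misses m = let u , su∧iu = anyFin⁻ _ m in
          T-not⁻ (T-∧⁻ʳ {X u} (S⊆X′ u (T-∧⁻ˡ su∧iu))) (T-∧⁻ʳ {lookup S u} su∧iu)

    pivot-bound : ∀ N s → arcCount G < 2 * N → card X ≤ N →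
                  (∀ N′ → arcCount G′ < 2 * N′ → card (nonIsolated G′) ≤ N′ →
                     count n (2 + s) (strongSet G′) ≤ (N′ ∸ 1) C (1 + s)) →
                  count n (2 + s) (strongSet G) ≤ (N ∸ 1) C (1 + s)
    pivot-bound N s m<2N ∣X∣≤N bound′ = ℕ.+-cancelʳ-≤ _ _ _ (begin
      count n (2 + s) (strongSet G) + (card X′ ∸ 1) C (1 + s)
        ≤⟨ pivot-count s ⟩
      count n (2 + s) (strongSet G′) + (card X ∸ 1) C (1 + s)
        ≤⟨ ℕ.+-monoˡ-≤ _ (bound′ (N ∸ d) m′<2[N∸d] ∣X[G′]∣≤N∸d) ⟩
      (N ∸ d ∸ 1) C (1 + s) + (card X ∸ 1) C (1 + s)
        ≡⟨ cong (λ x → (N ∸ d ∸ 1) C (1 + s) + (x ∸ 1) C (1 + s)) (sym ∣X′∣+∣I∣≡∣X∣) ⟩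
      (N ∸ d ∸ 1) C (1 + s) + (card X′ + d ∸ 1) C (1 + s)
        ≤⟨ C-increments-mono-∸ (1 + s) (1≤card X′ v v∈X′) (ℕ.≤-trans (ℕ.≤-reflexive ∣X′∣+∣I∣≡∣X∣) ∣X∣≤N) ⟩
      (N ∸ 1) C (1 + s) + (card X′ ∸ 1) C (1 + s) ∎)
      where
      open ℕ.≤-Reasoning
      d : ℕ
      d = card I
      ∣X∣+d≤1+N : card X + d ≤ suc N
      ∣X∣+d≤1+N = x+d≤1+N d (card X) m<2N ∣I∣*∣X∣≤arcCount
                    (card-< I X v I⊆nonIsolated v-nonIsolated v∉I) ∣X∣≤N
      m′<2[N∸d] : arcCount G′ < 2 * (N ∸ d)
      m′<2[N∸d] = subst (arcCount G′ <_) (sym (ℕ.*-distribˡ-∸ 2 N d))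
        (ℕ.m+n≤o⇒m≤o∸n (suc (arcCount G′)) (ℕ.≤-trans (s≤s arcCount-G′+2∣I∣≤arcCount) m<2N))
      ∣X[G′]∣≤N∸d : card (nonIsolated G′) ≤ N ∸ d
      ∣X[G′]∣≤N∸d = ℕ.m+n≤o⇒m≤o∸n _ (s≤s⁻¹ (ℕ.≤-trans (ℕ.+-monoˡ-≤ d ∣X[G′]∣<∣X∣) ∣X∣+d≤1+N))

  ∃-argmin : ∀ {n} (X : Fin n → Bool) (f : Fin n → ℕ) u → T (X u) →
             ∃ λ v → T (X v) × (∀ w → T (X w) → f v ≤ f w)
  ∃-argmin {n} X f u xu =
    argmin f u candidates ,
    argmin-all f {xs = candidates} xu (All.tabulate (proj₂ ∘ ∈-filter⁻ X? {xs = allFin n})) ,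
    λ w xw → f[argmin]≤v⁺ u candidates (inj₂ (lose (∈-filter⁺ X? (∈-allFin w) xw) ℕ.≤-refl))
    where
    X? : ∀ w → Dec (T (X w))
    X? w = T? (X w)
    candidates : List (Fin n)
    candidates = filter X? (allFin n)

  minDegPivot : ∀ {n} (G : Digraph n) v → T (nonIsolated G v) →
                (∀ w → T (nonIsolated G w) → minDeg G v ≤ minDeg G w) → Pivot G
  minDegPivot G v xv vmin with indeg G v ≤? outdeg G v
  ... | yes in≤out = record
    { v             = v
    ; I             = λ u → arc G u v
    ; v-nonIsolated = xv
    ; I⊆nonIsolated = λ u uv → anyFin⁺ _ v (T-∨⁺ˡ uv)
    ; v∉I           = subst T (loopless G v)
    ; I-meets       = λ S sc 2≤∣S∣ → strongSet-inArc G S sc 2≤∣S∣ v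
    ; ∣I∣≤minDeg    = λ w xw → subst (_≤ minDeg G w) (ℕ.m≤n⇒m⊓n≡m in≤out) (vmin w xw)
    }
  ... | no in≰out = record
    { v             = v
    ; I             = arc G v
    ; v-nonIsolated = xv
    ; I⊆nonIsolated = λ u vu → anyFin⁺ _ v (T-∨⁺ʳ {arc G u v} vu)
    ; v∉I           = subst T (loopless G v)
    ; I-meets       = λ S sc 2≤∣S∣ → strongSet-outArc G S sc 2≤∣S∣ v
    ; ∣I∣≤minDeg    = λ w xw → subst (_≤ minDeg G w) (ℕ.m≥n⇒m⊓n≡n (ℕ.<⇒≤ (ℕ.≰⇒> in≰out))) (vmin w xw)
    }

  strongSet-count-bound : ∀ {n} (G : Digraph n) N → arcCount G < 2 * N → card (nonIsolated G) ≤ N →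
                          ∀ s → count n (2 + s) (strongSet G) ≤ (N ∸ 1) C (1 + s)
  strongSet-count-bound G = bound G (<-wellFounded (arcCount G))
    where
    bound : ∀ {n} (G : Digraph n) → Acc _<_ (arcCount G) → ∀ N → arcCount G < 2 * N →
            card (nonIsolated G) ≤ N → ∀ s → count n (2 + s) (strongSet G) ≤ (N ∸ 1) C (1 + s)
    bound {n} G (acc rec) N m<2N ∣X∣≤N s with T? (anyFin (nonIsolated G))
    ... | no noneNonIsolated = ℕ.≤-trans (ℕ.≤-reflexive (countIn-none (2 + s) notStrong (subsets n))) z≤n
      where
      notStrong : ∀ S → ∣ S ∣ ≡ 2 + s → ¬ T (strongSet G S)
      notStrong S ∣S∣≡2+s sc =
        let 2≤∣S∣ = ℕ.≤-trans (s≤s (s≤s z≤n)) (ℕ.≤-reflexive (sym ∣S∣≡2+s))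
            u , su = 1≤∣∣⇒lookup S (ℕ.≤-trans (s≤s z≤n) 2≤∣S∣)
        in noneNonIsolated (anyFin⁺ _ u (strongSet-nonIsolated G S sc 2≤∣S∣ u su))
    ... | yes someNonIsolated =
      let u , xu        = anyFin⁻ _ someNonIsolated
          v , xv , vmin = ∃-argmin (nonIsolated G) (minDeg G) u xu
          open PivotProperties (minDegPivot G v xv vmin)
      in pivot-bound N s m<2N ∣X∣≤N λ N′ m′<2N′ ∣X′∣≤N′ →
           bound G′ (rec arcCount-G′<arcCount) N′ m′<2N′ ∣X′∣≤N′ s

  -- Reliability as a weighted count

  0≤* : ∀ {a b} → 0ℚ ≤ℚ a → 0ℚ ≤ℚ b → 0ℚ ≤ℚ a *ℚ b
  0≤* {a} {b} 0≤a 0≤b =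
    ℚ.nonNegative⁻¹ _ {{ℚ.nonNeg*nonNeg⇒nonNeg a {{nonNegative 0≤a}} b {{nonNegative 0≤b}}}}

  0≤· : ∀ k {x} → 0ℚ ≤ℚ x → 0ℚ ≤ℚ k · x
  0≤· zero    _   = ℚ.≤-refl
  0≤· (suc k) 0≤x = ℚ.≤-trans (ℚ.≤-reflexive (sym (ℚ.+-identityˡ 0ℚ))) (ℚ.+-mono-≤ 0≤x (0≤· k 0≤x))

  ·-monoˡ-≤ : ∀ {x j k} → 0ℚ ≤ℚ x → j ≤ k → j · x ≤ℚ k · x
  ·-monoˡ-≤ {k = k} 0≤x z≤n     = 0≤· k 0≤x
  ·-monoˡ-≤ {x}     0≤x (s≤s j≤k) = ℚ.+-monoʳ-≤ x (·-monoˡ-≤ 0≤x j≤k)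

  sumTo : ℕ → (ℕ → ℚ) → ℚ
  sumTo zero    f = f 0
  sumTo (suc n) f = f 0 +ℚ sumTo n (f ∘ suc)

  sumTo-cong : ∀ n {f g : ℕ → ℚ} → f ≗ g → sumTo n f ≡ sumTo n g
  sumTo-cong zero    f≗g = f≗g 0
  sumTo-cong (suc n) f≗g = cong₂ _+ℚ_ (f≗g 0) (sumTo-cong n (f≗g ∘ suc))

  sumTo-zero : ∀ n → sumTo n (λ _ → 0ℚ) ≡ 0ℚ
  sumTo-zero zero    = refl
  sumTo-zero (suc n) = cong (0ℚ +ℚ_) (sumTo-zero n)

  sumTo-distrib-+ : ∀ n (f g : ℕ → ℚ) → sumTo n (λ r → f r +ℚ g r) ≡ sumTo n f +ℚ sumTo n g
  sumTo-distrib-+ zero    f g = refl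
  sumTo-distrib-+ (suc n) f g = trans (cong ((f 0 +ℚ g 0) +ℚ_) (sumTo-distrib-+ n (f ∘ suc) (g ∘ suc)))
    (+ℚ-interchange (f 0) (g 0) (sumTo n (f ∘ suc)) (sumTo n (g ∘ suc)))

  sumTo-mono-≤ : ∀ n {f g : ℕ → ℚ} → (∀ r → f r ≤ℚ g r) → sumTo n f ≤ℚ sumTo n g
  sumTo-mono-≤ zero    f≤g = f≤g 0
  sumTo-mono-≤ (suc n) f≤g = ℚ.+-mono-≤ (f≤g 0) (sumTo-mono-≤ n (f≤g ∘ suc))

  sumTo-δ : ∀ n k (f : ℕ → ℚ) → k ≤ n → sumTo n (λ r → b2n (k ≡ᵇ r) · f r) ≡ f k
  sumTo-δ zero    zero    f _       = ℚ.+-identityʳ (f 0)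
  sumTo-δ (suc n) zero    f _       = trans (cong ((f 0 +ℚ 0ℚ) +ℚ_) (sumTo-zero n))
                                            (trans (ℚ.+-identityʳ _) (ℚ.+-identityʳ (f 0)))
  sumTo-δ (suc n) (suc k) f (s≤s k≤n) = trans (ℚ.+-identityˡ _) (sumTo-δ n k (f ∘ suc) k≤n)

  module _ (p : ℚ) where

    -- p ^ r * (1 - p) ^ (n - r) for r ≤ n: the weight of every r-element subset of Fin n.
    weightBySize : ℕ → ℕ → ℚ
    weightBySize zero    _       = 1ℚ
    weightBySize (suc n) zero    = (1ℚ - p) *ℚ weightBySize n zero
    weightBySize (suc n) (suc r) = p *ℚ weightBySize n r

    weightBySize-suc : ∀ n r → r ≤ n → (1ℚ - p) *ℚ weightBySize n r ≡ weightBySize (suc n) r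
    weightBySize-suc n       zero    _         = refl
    weightBySize-suc (suc n) (suc r) (s≤s r≤n) = begin
      (1ℚ - p) *ℚ (p *ℚ weightBySize n r)   ≡⟨ ℚ-left-comm (1ℚ - p) p (weightBySize n r) ⟩
      p *ℚ ((1ℚ - p) *ℚ weightBySize n r)   ≡⟨ cong (p *ℚ_) (weightBySize-suc n r r≤n) ⟩
      p *ℚ weightBySize (suc n) r           ∎
      where open ≡-Reasoning

    weight≡weightBySize : ∀ {n} (S : Subset n) → weight p S ≡ weightBySize n ∣ S ∣
    weight≡weightBySize []          = refl
    weight≡weightBySize (true  ∷ S) = cong (p *ℚ_) (weight≡weightBySize S)
    weight≡weightBySize (false ∷ S) =
      trans (cong ((1ℚ - p) *ℚ_) (weight≡weightBySize S)) (weightBySize-suc _ ∣ S ∣ (∣p∣≤n S))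

    sumWeights≡sumTo-count : ∀ {n} (P : Subset n → Bool) (L : List (Subset n)) →
      foldr (λ S acc → (if P S then weight p S else 0ℚ) +ℚ acc) 0ℚ L ≡
      sumTo n (λ r → countIn r P L · weightBySize n r)
    sumWeights≡sumTo-count {n} P []      = sym (sumTo-zero n)
    sumWeights≡sumTo-count {n} P (S ∷ L) = begin
      term +ℚ foldr (λ S acc → (if P S then weight p S else 0ℚ) +ℚ acc) 0ℚ L
        ≡⟨ cong₂ _+ℚ_ (sym (term≡sumTo (P S))) (sumWeights≡sumTo-count P L) ⟩
      sumTo n (λ r → b2n (P S ∧ (∣ S ∣ ≡ᵇ r)) · weightBySize n r) +ℚ
      sumTo n (λ r → countIn r P L · weightBySize n r)
        ≡⟨ sumTo-distrib-+ n _ _ ⟨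
      sumTo n (λ r → b2n (P S ∧ (∣ S ∣ ≡ᵇ r)) · weightBySize n r +ℚ countIn r P L · weightBySize n r)
        ≡⟨ sumTo-cong n (λ r → ×-homo-+ (weightBySize n r) (b2n (P S ∧ (∣ S ∣ ≡ᵇ r))) (countIn r P L)) ⟨
      sumTo n (λ r → countIn r P (S ∷ L) · weightBySize n r) ∎
      where
      open ≡-Reasoning
      term : ℚ
      term = if P S then weight p S else 0ℚ
      term≡sumTo : ∀ b → sumTo n (λ r → b2n (b ∧ (∣ S ∣ ≡ᵇ r)) · weightBySize n r) ≡
                         (if b then weight p S else 0ℚ)
      term≡sumTo true  = trans (sumTo-δ n ∣ S ∣ (weightBySize n) (∣p∣≤n S)) (sym (weight≡weightBySize S))
      term≡sumTo false = sumTo-zero n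

    Rel≡sumTo-count : ∀ {n} (G : Digraph n) →
                      Rel G p ≡ sumTo n (λ r → count n r (strongSet G) · weightBySize n r)
    Rel≡sumTo-count {n} G = sumWeights≡sumTo-count (strongSet G) (subsets n)

    module _ (0≤p : 0ℚ ≤ℚ p) (p≤1 : p ≤ℚ 1ℚ) where

      0≤weightBySize : ∀ n r → 0ℚ ≤ℚ weightBySize n r
      0≤weightBySize zero    _       = ℚ.nonNegative⁻¹ 1ℚ
      0≤weightBySize (suc n) zero    = 0≤* 0≤1-p (0≤weightBySize n zero)
        where
        0≤1-p : 0ℚ ≤ℚ 1ℚ - p
        0≤1-p = ℚ.≤-trans (ℚ.≤-reflexive (sym (ℚ.+-inverseʳ p))) (ℚ.+-monoˡ-≤ (- p) p≤1)
      0≤weightBySize (suc n) (suc r) = 0≤* 0≤p (0≤weightBySize n r)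

      Rel-mono-count : ∀ {n} (G H : Digraph n) → (∀ r → count n r (strongSet G) ≤ count n r (strongSet H)) →
                       Rel G p ≤ℚ Rel H p
      Rel-mono-count {n} G H G≤H = subst₂ _≤ℚ_ (sym (Rel≡sumTo-count G)) (sym (Rel≡sumTo-count H))
        (sumTo-mono-≤ n (λ r → ·-monoˡ-≤ (0≤weightBySize n r) (G≤H r)))

  -- Comparison with D

  count-strongSet-≤1 : ∀ {n} (G H : Digraph n) r → r ≤ 1 → count n r (strongSet G) ≤ count n r (strongSet H)
  count-strongSet-≤1 {n} G H r r≤1 = countIn-mono r
    (λ S ∣S∣≡r sc → strongSet-≤1 H S (T-∧⁻ˡ sc) (ℕ.≤-trans (ℕ.≤-reflexive ∣S∣≡r) r≤1)) (subsets n)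

  count-strongSet-≤-D : ∀ k (G : Digraph (3 + k)) → arcCount G < 2 * (3 + k) →
                        ∀ r → count (3 + k) r (strongSet G) ≤ count (3 + k) r (strongSet (D k))
  count-strongSet-≤-D k G _ 0 = count-strongSet-≤1 G (D k) 0 z≤n
  count-strongSet-≤-D k G _ 1 = count-strongSet-≤1 G (D k) 1 ℕ.≤-refl
  count-strongSet-≤-D k G m<2n (suc (suc s)) = begin
    count (3 + k) (2 + s) (strongSet G)
      ≤⟨ strongSet-count-bound G (3 + k) m<2n (card-≤ (nonIsolated G)) s ⟩
    (3 + k ∸ 1) C (1 + s)
      ≡⟨ cong (λ c → (c ∸ 1) C (1 + s)) (card-full (3 + k)) ⟨
    (card {3 + k} (λ _ → true) ∸ 1) C (1 + s)
      ≡⟨ count-∋-⊆ (3 + k) (λ _ → true) zero _ (1 + s) ⟨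
    count (3 + k) (2 + s) (λ S → lookup S zero ∧ S ⊆ᵇ (λ _ → true))
      ≤⟨ countIn-mono (2 + s) (λ S _ t → strongSet-D k S (T-∧⁻ˡ t)) (subsets (3 + k)) ⟩
    count (3 + k) (2 + s) (strongSet (D k)) ∎
    where open ℕ.≤-Reasoning


open import Data.Rational using (_≤_)

mainTheorem4 : (k : ℕ) (G : Digraph (3 + k)) →
               StronglyConnected G →
               arcCount G ≡ 2 * (3 + k) ∸ 1 →
               (p : ℚ) → 0ℚ ≤ p → p ≤ 1ℚ →
               Rel G p ≤ Rel (D k) p
mainTheorem4 k G _ m≡2n-1 p 0≤p p≤1 =
  Rel-mono-count p 0≤p p≤1 G (D k) (count-strongSet-≤-D k G (ℕ.≤-reflexive (cong suc m≡2n-1)))
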